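{- Let $k\ge 1$ be an integer and for $N\ge 0$ let $\gamma^{(k)}_N$ be the $N\times N$ matrix (rows and columns indexed by $0,\dots,N-1$) whose $(i,j)$ entry is $1$ if $|i-j|=k$ or $i+j=k-1$, and $0$ otherwise. Then for every integer $n\ge 0$, $$\det(\gamma^{(k)}_{2kn})=(-1)^{kn},\qquad \det(\gamma^{(k)}_{2kn+k})=(-1)^{kn+\binom{k}{2}},$$ and $\det(\gamma^{(k)}_N)=0$ for every $N\ge 0$ not of the form $2kn$ or $2kn+k$ with $n\ge 0$.
   Context: The determinant of a $0\times 0$ matrix is $1$. -}

module Defs where

open import Data.Nat as ℕ using (ℕ; zero; suc; _+_; _*_)
open import Data.Nat.Combinatorics using (_C_)
open import Data.Fin using (Fin; zero; suc; toℕ; punchIn)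
open import Data.Integer as ℤ using (ℤ; +_; -_)
open import Data.Bool using (Bool; true; false; if_then_else_; _∨_)
open import Relation.Nullary.Decidable using (⌊_⌋)

Matrix : ℕ → Set
Matrix n = Fin n → Fin n → ℤ

sign : ℕ → ℤ
sign zero = + 1
sign (suc e) = - sign e

sumFin : (n : ℕ) → (Fin n → ℤ) → ℤ
sumFin zero f = + 0
sumFin (suc n) f = f zero ℤ.+ sumFin n (λ j → f (suc j))

minor : ∀ {n} → Matrix (suc n) → Fin (suc n) → Matrix n
minor M j r c = M (suc r) (punchIn j c)

det : (n : ℕ) → Matrix n → ℤ
det zero M = + 1
det (suc n) M = sumFin (suc n) (λ j → sign (toℕ j) ℤ.* (M zero j ℤ.* det n (minor M j)))

absDiff : ℕ → ℕ → ℕ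
absDiff a b = ℕ.∣ a - b ∣

gamma : (k N : ℕ) → Matrix N
gamma k N i j =
  if ⌊ absDiff (toℕ i) (toℕ j) ℕ.≟ k ⌋ ∨ ⌊ toℕ i + toℕ j ℕ.≟ k ℕ.∸ 1 ⌋
  then + 1 else + 0

module Submission where

open import Defs

-- Write K = k ≥ 1 and D N = det γ^(K)_N.  The last K rows of γ_(m+2K) are the
-- unit rows e_m, …, e_(m+K-1); expanding along them leaves a block lower
-- triangular matrix whose diagonal blocks are γ_m and the K × K identity.
-- Hence D (m + 2K) = (-1)^(K·K) D m = (-1)^K D m, and D (2Kq + r) = (-1)^(Kq) D r.
-- Among the residues r < 2K: D 0 = 1; γ_K is the anti-diagonal pattern, so
-- D K = (-1)^(K choose 2); for 0 < r < K row 0 of γ_r vanishes; for K < r < 2K,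
-- expanding along row K (the unit row e_0) leaves a minor whose row K - 1 is zero.

module RowOperations where

  open import Data.Nat as ℕ using (zero; suc)
  open import Data.Fin as F using (Fin; zero; suc; toℕ; punchIn; punchOut)
  open import Data.Fin.Properties using (punchInᵢ≢i; punchOut-punchIn; punchOut-cong; punchIn-punchOut)
  open import Data.Integer using (ℤ; +_; -_; _+_; _*_)
  open import Data.Integer.Properties
    using (+-identityˡ; +-identityʳ; *-identityˡ; *-zeroʳ; *-assoc; *-distribˡ-+; neg-distrib-+; neg-distribˡ-*)
  open import Data.Integer.Tactic.RingSolver using (solve-∀)
  import Data.Nat.Tactic.RingSolver as ℕ-Solver
  open import Data.Empty using (⊥-elim)
  open import Function using (_∘_)
  open import Relation.Binary.PropositionalEquality
  open import Relation.Nullary using (yes; no)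

  sum-cong : ∀ n {f g : Fin n → ℤ} → (∀ i → f i ≡ g i) → sumFin n f ≡ sumFin n g
  sum-cong zero    e = refl
  sum-cong (suc n) e = cong₂ _+_ (e zero) (sum-cong n (e ∘ suc))

  sum-zero : ∀ n {f : Fin n → ℤ} → (∀ i → f i ≡ + 0) → sumFin n f ≡ + 0
  sum-zero zero    e = refl
  sum-zero (suc n) e = cong₂ _+_ (e zero) (sum-zero n (e ∘ suc))

  sum-+ : ∀ n (f g : Fin n → ℤ) → sumFin n (λ i → f i + g i) ≡ sumFin n f + sumFin n g
  sum-+ zero    f g = refl
  sum-+ (suc n) f g =
    trans (cong (_+_ (f zero + g zero)) (sum-+ n (f ∘ suc) (g ∘ suc))) (interchange (f zero) (g zero) _ _)
    where
    interchange : ∀ a b c d → a + b + (c + d) ≡ a + c + (b + d)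
    interchange = solve-∀

  sum-neg : ∀ n (f : Fin n → ℤ) → sumFin n (λ i → - f i) ≡ - sumFin n f
  sum-neg zero    f = refl
  sum-neg (suc n) f =
    trans (cong (_+_ (- f zero)) (sum-neg n (f ∘ suc))) (sym (neg-distrib-+ (f zero) _))

  sum-*ˡ : ∀ n a (f : Fin n → ℤ) → sumFin n (λ i → a * f i) ≡ a * sumFin n f
  sum-*ˡ zero    a f = sym (*-zeroʳ a)
  sum-*ˡ (suc n) a f =
    trans (cong (_+_ (a * f zero)) (sum-*ˡ n a (f ∘ suc))) (sym (*-distribˡ-+ a (f zero) _))

  sum-swap : ∀ m n (g : Fin m → Fin n → ℤ) →
    sumFin m (λ a → sumFin n (g a)) ≡ sumFin n (λ b → sumFin m (λ a → g a b))
  sum-swap zero    n g = sym (sum-zero n (λ _ → refl))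
  sum-swap (suc m) n g =
    trans (cong (_+_ (sumFin n (g zero))) (sum-swap m n (g ∘ suc)))
          (sym (sum-+ n (g zero) (λ b → sumFin m (λ a → g (suc a) b))))

  sum-punchIn : ∀ n (i : Fin (suc n)) (f : Fin (suc n) → ℤ) →
    sumFin (suc n) f ≡ f i + sumFin n (f ∘ punchIn i)
  sum-punchIn n       zero    f = refl
  sum-punchIn (suc n) (suc i) f =
    trans (cong (_+_ (f zero)) (sum-punchIn n i (f ∘ suc))) (exchange (f zero) (f (suc i)) _)
    where
    exchange : ∀ a b c → a + (b + c) ≡ b + (a + c)
    exchange = solve-∀

  sum-single : ∀ n (i : Fin (suc n)) (f : Fin (suc n) → ℤ) →
    (∀ j → j ≢ i → f j ≡ + 0) → sumFin (suc n) f ≡ f i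
  sum-single n i f others = begin
    sumFin (suc n) f                 ≡⟨ sum-punchIn n i f ⟩
    f i + sumFin n (f ∘ punchIn i)   ≡⟨ cong (_+_ (f i)) (sum-zero n (λ j → others (punchIn i j) (punchInᵢ≢i i j))) ⟩
    f i + + 0                        ≡⟨ +-identityʳ (f i) ⟩
    f i                              ∎
    where open ≡-Reasoning

  sign-+ : ∀ a b → sign (a ℕ.+ b) ≡ sign a * sign b
  sign-+ zero    b = sym (*-identityˡ (sign b))
  sign-+ (suc a) b = trans (cong -_ (sign-+ a b)) (neg-distribˡ-* (sign a) (sign b))

  sign-sq : ∀ e → sign e * sign e ≡ + 1
  sign-sq zero    = refl
  sign-sq (suc e) = trans (negSquare (sign e)) (sign-sq e)
    where
    negSquare : ∀ x → - x * - x ≡ x * x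
    negSquare = solve-∀

  sign-double : ∀ e → sign (e ℕ.+ e) ≡ + 1
  sign-double e = trans (sign-+ e e) (sign-sq e)

  -- (-1)^(a·a) = (-1)^a, since a·a and a have the same parity.
  sign-square : ∀ a → sign (a ℕ.* a) ≡ sign a
  sign-square zero    = refl
  sign-square (suc a) = cong -_ (begin
    sign (a ℕ.+ a ℕ.* suc a)                 ≡⟨ cong sign (regroup a) ⟩
    sign ((a ℕ.+ a) ℕ.+ a ℕ.* a)             ≡⟨ sign-+ (a ℕ.+ a) (a ℕ.* a) ⟩
    sign (a ℕ.+ a) * sign (a ℕ.* a)          ≡⟨ cong₂ _*_ (sign-double a) (sign-square a) ⟩
    + 1 * sign a                              ≡⟨ *-identityˡ (sign a) ⟩
    sign a ∎)
    where
    open ≡-Reasoning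
    regroup : ∀ a → a ℕ.+ a ℕ.* suc a ≡ (a ℕ.+ a) ℕ.+ a ℕ.* a
    regroup = ℕ-Solver.solve-∀

  det-cong : ∀ n {M M′ : Matrix n} → (∀ i j → M i j ≡ M′ i j) → det n M ≡ det n M′
  det-cong zero    e = refl
  det-cong (suc n) e = sum-cong (suc n) λ j →
    cong₂ (λ x d → sign (toℕ j) * (x * d)) (e zero j) (det-cong n (λ r c → e (suc r) (punchIn j c)))

  liftRows : ∀ {n} → (Fin n → Fin n) → Fin (suc n) → Fin (suc n)
  liftRows ρ zero    = zero
  liftRows ρ (suc r) = suc (ρ r)

  -- If reindexing rows by ρ multiplies every determinant by s, so does its lift:
  -- the first-row expansion applies ρ to the rows of every minor.
  det-liftRows : ∀ n (ρ : Fin n → Fin n) s → (∀ M → det n (M ∘ ρ) ≡ s * det n M) →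
    ∀ M → det (suc n) (M ∘ liftRows ρ) ≡ s * det (suc n) M
  det-liftRows n ρ s det-ρ M =
    trans (sum-cong (suc n) λ j → trans (cong (λ d → sign (toℕ j) * (M zero j * d)) (det-ρ (minor M j)))
                                        (reassoc (sign (toℕ j)) (M zero j) s _))
          (sum-*ˡ (suc n) s (λ j → sign (toℕ j) * (M zero j * det n (minor M j))))
    where
    reassoc : ∀ σ x s d → σ * (x * (s * d)) ≡ s * (σ * (x * d))
    reassoc = solve-∀

  -- Expanding twice: the determinant as a double sum over the columns a, b
  -- chosen in rows 0 and 1 (b indexes the columns left after deleting a).
  twoRowTerm : ∀ {n} → Matrix (suc (suc n)) → Fin (suc (suc n)) → Fin (suc n) → ℤ
  twoRowTerm {n} M a b =
    sign (toℕ a) * (M zero a * (sign (toℕ b) * (M (suc zero) (punchIn a b) *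
      det n (λ r c → M (suc (suc r)) (punchIn a (punchIn b c))))))

  det-twoRows : ∀ n (M : Matrix (suc (suc n))) →
    det (suc (suc n)) M ≡ sumFin (suc (suc n)) (λ a → sumFin (suc n) (twoRowTerm M a))
  det-twoRows n M = sum-cong (suc (suc n)) λ a →
    trans (cong (sign (toℕ a) *_) (sym (sum-*ˡ (suc n) (M zero a) (inner a))))
          (sym (sum-*ˡ (suc n) (sign (toℕ a)) (λ b → M zero a * inner a b)))
    where
    inner : Fin (suc (suc n)) → Fin (suc n) → ℤ
    inner a b = sign (toℕ b) * (M (suc zero) (punchIn a b) *
                  det n (λ r c → M (suc (suc r)) (punchIn a (punchIn b c))))

  -- The same double sum indexed by ordered pairs of columns of the full matrix;
  -- pairs with a ≡ b contribute nothing.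
  pairTerm : ∀ {n} → Matrix (suc (suc n)) → Fin (suc (suc n)) → Fin (suc (suc n)) → ℤ
  pairTerm M a b with a F.≟ b
  ... | yes _   = + 0
  ... | no a≢b = twoRowTerm M a (punchOut a≢b)

  pairTerm-diagonal : ∀ {n} (M : Matrix (suc (suc n))) a → pairTerm M a a ≡ + 0
  pairTerm-diagonal M a with a F.≟ a
  ... | yes _   = refl
  ... | no a≢a = ⊥-elim (a≢a refl)

  pairTerm-punchIn : ∀ {n} (M : Matrix (suc (suc n))) a b → pairTerm M a (punchIn a b) ≡ twoRowTerm M a b
  pairTerm-punchIn M a b with a F.≟ punchIn a b
  ... | yes a≡ = ⊥-elim (punchInᵢ≢i a b (sym a≡))
  ... | no a≢ = cong (twoRowTerm M a) (trans (punchOut-cong a refl) (punchOut-punchIn a))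

  det-pairs : ∀ n (M : Matrix (suc (suc n))) →
    det (suc (suc n)) M ≡ sumFin (suc (suc n)) (λ a → sumFin (suc (suc n)) (pairTerm M a))
  det-pairs n M = trans (det-twoRows n M) (sum-cong (suc (suc n)) λ a → sym (begin
    sumFin (suc (suc n)) (pairTerm M a)
      ≡⟨ sum-punchIn (suc n) a (pairTerm M a) ⟩
    pairTerm M a a + sumFin (suc n) (pairTerm M a ∘ punchIn a)
      ≡⟨ cong₂ _+_ (pairTerm-diagonal M a) (sum-cong (suc n) (pairTerm-punchIn M a)) ⟩
    + 0 + sumFin (suc n) (twoRowTerm M a)
      ≡⟨ +-identityˡ _ ⟩
    sumFin (suc n) (twoRowTerm M a) ∎))
    where open ≡-Reasoning

  -- Deleting columns a and b leaves the same columns whichever is deleted first.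
  punchIn-twice : ∀ {n} (a b : Fin (suc (suc n))) (a≢b : a ≢ b) (b≢a : b ≢ a) (c : Fin n) →
    punchIn a (punchIn (punchOut a≢b) c) ≡ punchIn b (punchIn (punchOut b≢a) c)
  punchIn-twice zero    zero    a≢b b≢a c = ⊥-elim (a≢b refl)
  punchIn-twice zero    (suc b) a≢b b≢a c = refl
  punchIn-twice (suc a) zero    a≢b b≢a c = refl
  punchIn-twice {suc n} (suc a) (suc b) a≢b b≢a zero    = refl
  punchIn-twice {suc n} (suc a) (suc b) a≢b b≢a (suc c) =
    cong suc (punchIn-twice a b (a≢b ∘ cong suc) (b≢a ∘ cong suc) c)

  -- The two orders of deleting columns a and b carry opposite signs.
  sign-punchOut : ∀ {n} (a b : Fin (suc (suc n))) (a≢b : a ≢ b) (b≢a : b ≢ a) →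
    sign (toℕ a) * sign (toℕ (punchOut a≢b)) ≡ - (sign (toℕ b) * sign (toℕ (punchOut b≢a)))
  sign-punchOut zero zero a≢b b≢a = ⊥-elim (a≢b refl)
  sign-punchOut zero (suc b) a≢b b≢a = flip₁ (sign (toℕ b))
    where
    flip₁ : ∀ x → + 1 * x ≡ - (- x * + 1)
    flip₁ = solve-∀
  sign-punchOut (suc a) zero a≢b b≢a = flip₂ (sign (toℕ a))
    where
    flip₂ : ∀ x → - x * + 1 ≡ - (+ 1 * x)
    flip₂ = solve-∀
  sign-punchOut {zero}  (suc zero) (suc zero) a≢b b≢a = ⊥-elim (a≢b refl)
  sign-punchOut {suc n} (suc a) (suc b) a≢b b≢a =
    trans (negBoth (sign (toℕ a)) _)
          (trans (sign-punchOut a b (a≢b ∘ cong suc) (b≢a ∘ cong suc)) (cong -_ (sym (negBoth (sign (toℕ b)) _))))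
    where
    negBoth : ∀ x y → - x * - y ≡ x * y
    negBoth = solve-∀

  swap01 : ∀ {n} → Fin (suc (suc n)) → Fin (suc (suc n))
  swap01 zero             = suc zero
  swap01 (suc zero)       = zero
  swap01 (suc (suc r))    = suc (suc r)

  pairTerm-swap01 : ∀ {n} (M : Matrix (suc (suc n))) a b → pairTerm (M ∘ swap01) a b ≡ - pairTerm M b a
  pairTerm-swap01 M a b with a F.≟ b | b F.≟ a
  ... | yes _   | yes _   = refl
  ... | yes a≡b | no b≢a = ⊥-elim (b≢a (sym a≡b))
  ... | no a≢b | yes b≡a = ⊥-elim (a≢b (sym b≡a))
  ... | no a≢b | no b≢a = begin
    sign (toℕ a) * (M (suc zero) a * (sign (toℕ a′) * (M zero (punchIn a a′) * Dₐ)))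
      ≡⟨ regroup (sign (toℕ a)) (sign (toℕ a′)) (M (suc zero) a) (M zero (punchIn a a′)) Dₐ ⟩
    sign (toℕ a) * sign (toℕ a′) * (M (suc zero) a * (M zero (punchIn a a′) * Dₐ))
      ≡⟨ cong₂ _*_ (sign-punchOut a b a≢b b≢a)
                   (cong₂ (λ x y → x * (y * Dₐ)) (cong (M (suc zero)) (sym (punchIn-punchOut b≢a)))
                                                  (cong (M zero) (punchIn-punchOut a≢b))) ⟩
    - (sign (toℕ b) * sign (toℕ b′)) * (M (suc zero) (punchIn b b′) * (M zero b * Dₐ))
      ≡⟨ cong (λ d → - (sign (toℕ b) * sign (toℕ b′)) * (M (suc zero) (punchIn b b′) * (M zero b * d)))
              (det-cong _ (λ r c → cong (M (suc (suc r))) (punchIn-twice a b a≢b b≢a c))) ⟩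
    - (sign (toℕ b) * sign (toℕ b′)) * (M (suc zero) (punchIn b b′) * (M zero b * D_b))
      ≡⟨ ungroup (sign (toℕ b)) (sign (toℕ b′)) (M (suc zero) (punchIn b b′)) (M zero b) D_b ⟩
    - (sign (toℕ b) * (M zero b * (sign (toℕ b′) * (M (suc zero) (punchIn b b′) * D_b)))) ∎
    where
    open ≡-Reasoning
    a′ = punchOut a≢b
    b′ = punchOut b≢a
    Dₐ = det _ (λ r c → M (suc (suc r)) (punchIn a (punchIn a′ c)))
    D_b = det _ (λ r c → M (suc (suc r)) (punchIn b (punchIn b′ c)))
    regroup : ∀ σ τ x y d → σ * (x * (τ * (y * d))) ≡ (σ * τ) * (x * (y * d))
    regroup = solve-∀
    ungroup : ∀ σ τ x y d → - (σ * τ) * (x * (y * d)) ≡ - (σ * (y * (τ * (x * d))))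
    ungroup = solve-∀

  det-swap01 : ∀ n (M : Matrix (suc (suc n))) → det (suc (suc n)) (M ∘ swap01) ≡ - det (suc (suc n)) M
  det-swap01 n M = begin
    det N (M ∘ swap01)
      ≡⟨ det-pairs n (M ∘ swap01) ⟩
    sumFin N (λ a → sumFin N (pairTerm (M ∘ swap01) a))
      ≡⟨ sum-cong N (λ a → trans (sum-cong N (pairTerm-swap01 M a)) (sum-neg N (λ b → pairTerm M b a))) ⟩
    sumFin N (λ a → - sumFin N (λ b → pairTerm M b a))
      ≡⟨ sum-neg N (λ a → sumFin N (λ b → pairTerm M b a)) ⟩
    - sumFin N (λ a → sumFin N (λ b → pairTerm M b a))
      ≡⟨ cong -_ (sum-swap N N (λ a b → pairTerm M b a)) ⟩
    - sumFin N (λ b → sumFin N (pairTerm M b))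
      ≡⟨ cong -_ (sym (det-pairs n M)) ⟩
    - det N M ∎
    where
    open ≡-Reasoning
    N = suc (suc n)

  moveUp : ∀ {n} → Fin (suc n) → Fin (suc n) → Fin (suc n)
  moveUp i zero    = i
  moveUp i (suc r) = punchIn i r

  moveUp-suc : ∀ {n} (i : Fin (suc n)) r → moveUp (suc i) r ≡ liftRows (moveUp i) (swap01 r)
  moveUp-suc i zero             = refl
  moveUp-suc i (suc zero)       = refl
  moveUp-suc i (suc (suc r))    = refl

  det-moveUp : ∀ n (i : Fin (suc n)) (M : Matrix (suc n)) →
    det (suc n) (M ∘ moveUp i) ≡ sign (toℕ i) * det (suc n) M
  det-moveUp n zero M = trans (det-cong (suc n) unchanged) (sym (*-identityˡ _))
    where
    unchanged : ∀ r c → M (moveUp zero r) c ≡ M r c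
    unchanged zero    c = refl
    unchanged (suc r) c = refl
  det-moveUp (suc n) (suc i) M = begin
    det (suc (suc n)) (M ∘ moveUp (suc i))
      ≡⟨ det-cong (suc (suc n)) (λ r c → cong (λ x → M x c) (moveUp-suc i r)) ⟩
    det (suc (suc n)) ((M ∘ liftRows (moveUp i)) ∘ swap01)
      ≡⟨ det-swap01 n (M ∘ liftRows (moveUp i)) ⟩
    - det (suc (suc n)) (M ∘ liftRows (moveUp i))
      ≡⟨ cong -_ (det-liftRows (suc n) (moveUp i) (sign (toℕ i)) (det-moveUp n i) M) ⟩
    - (sign (toℕ i) * det (suc (suc n)) M)
      ≡⟨ neg-distribˡ-* (sign (toℕ i)) _ ⟩
    - sign (toℕ i) * det (suc (suc n)) M ∎
    where open ≡-Reasoning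

  det-via-moveUp : ∀ n (i : Fin (suc n)) (M : Matrix (suc n)) →
    det (suc n) M ≡ sign (toℕ i) * det (suc n) (M ∘ moveUp i)
  det-via-moveUp n i M = begin
    det (suc n) M                                    ≡⟨ sym (*-identityˡ _) ⟩
    + 1 * det (suc n) M                              ≡⟨ cong (_* det (suc n) M) (sym (sign-sq (toℕ i))) ⟩
    sign (toℕ i) * sign (toℕ i) * det (suc n) M      ≡⟨ *-assoc (sign (toℕ i)) _ _ ⟩
    sign (toℕ i) * (sign (toℕ i) * det (suc n) M)    ≡⟨ cong (sign (toℕ i) *_) (sym (det-moveUp n i M)) ⟩
    sign (toℕ i) * det (suc n) (M ∘ moveUp i)        ∎
    where open ≡-Reasoning

  vanishing-term : ∀ σ d {x : ℤ} → x ≡ + 0 → σ * (x * d) ≡ + 0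
  vanishing-term σ d refl = *-zeroʳ σ

  det-unitRow : ∀ n (i j : Fin (suc n)) (M : Matrix (suc n)) →
    M i j ≡ + 1 → (∀ j′ → j′ ≢ j → M i j′ ≡ + 0) →
    det (suc n) M ≡ sign (toℕ i) * (sign (toℕ j) * det n (λ r c → M (punchIn i r) (punchIn j c)))
  det-unitRow n i j M one zeros = begin
    det (suc n) M
      ≡⟨ det-via-moveUp n i M ⟩
    sign (toℕ i) * det (suc n) (M ∘ moveUp i)
      ≡⟨ cong (sign (toℕ i) *_) (sum-single n j term other-terms) ⟩
    sign (toℕ i) * (sign (toℕ j) * (M i j * D))
      ≡⟨ cong (λ x → sign (toℕ i) * (sign (toℕ j) * x)) (trans (cong (_* D) one) (*-identityˡ D)) ⟩
    sign (toℕ i) * (sign (toℕ j) * D) ∎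
    where
    open ≡-Reasoning
    D = det n (λ r c → M (punchIn i r) (punchIn j c))
    minorDet : Fin (suc n) → ℤ
    minorDet c = det n (minor (M ∘ moveUp i) c)
    term : Fin (suc n) → ℤ
    term c = sign (toℕ c) * (M i c * minorDet c)
    other-terms : ∀ c → c ≢ j → term c ≡ + 0
    other-terms c c≢j = vanishing-term (sign (toℕ c)) (minorDet c) (zeros c c≢j)

  det-zeroRow : ∀ n (i : Fin (suc n)) (M : Matrix (suc n)) → (∀ j → M i j ≡ + 0) → det (suc n) M ≡ + 0
  det-zeroRow n i M zeros = begin
    det (suc n) M                                ≡⟨ det-via-moveUp n i M ⟩
    sign (toℕ i) * det (suc n) (M ∘ moveUp i)    ≡⟨ cong (sign (toℕ i) *_) (sum-zero (suc n) vanishing) ⟩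
    sign (toℕ i) * + 0                           ≡⟨ *-zeroʳ (sign (toℕ i)) ⟩
    + 0 ∎
    where
    open ≡-Reasoning
    vanishing : ∀ j → sign (toℕ j) * (M i j * det n (minor (M ∘ moveUp i) j)) ≡ + 0
    vanishing j = vanishing-term (sign (toℕ j)) (det n (minor (M ∘ moveUp i) j)) (zeros j)

open RowOperations

open import Data.Nat as ℕ using (ℕ; zero; suc; _+_; _*_; _∸_; _≤_; _<_; _≥_; z≤n; s≤s; ∣_-_∣)
open import Data.Nat.Properties
  using (≤-refl; ≤-trans; <-≤-trans; <-trans; ≮⇒≥; _<?_; <⇒≢; >⇒≢; ≤-total; <-cmp; +-suc; +-comm; +-identityʳ;
         m≤m+n; m≤n+m; m<m+n; n≤1+n; n<1+n; m<n⇒m<1+n; n≢0⇒n>0; +-cancelˡ-≡; +-cancelʳ-≡; +-monoˡ-≤; +-monoˡ-<;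
         +-monoʳ-<; suc-injective; m+[n∸m]≡n; m≤n⇒∣m-n∣≡n∸m; m≤n⇒∣n-m∣≡n∸m; ∣m-m+n∣≡n; ∣-∣-comm; *-suc)
import Data.Nat.Properties as ℕₚ
open import Data.Nat.DivMod using (_/_; _%_; m≡m%n+[m/n]*n; m%n<n)
open import Data.Nat.Combinatorics using (_C_; nC1≡n; nCk+nC[k+1]≡[n+1]C[k+1])
import Data.Nat.Tactic.RingSolver as ℕ-Solver
open import Data.Fin using (Fin; zero; suc; toℕ; punchIn; fromℕ<)
open import Data.Fin.Properties using (toℕ<n; toℕ-fromℕ<; toℕ-injective)
open import Data.Integer as ℤ using (ℤ; +_)
open import Data.Integer.Properties using (*-identityˡ; *-identityʳ; *-zeroʳ; *-assoc; *-comm)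
import Data.Integer.Properties as ℤₚ
open import Data.Integer.Tactic.RingSolver using (solve-∀)
open import Data.Bool using (if_then_else_; _∨_)
open import Data.Empty using (⊥-elim)
open import Data.Product using (_×_; _,_)
open import Data.Sum using (_⊎_; inj₁; inj₂)
open import Function using (_∘_)
open import Relation.Binary.Definitions using (tri<; tri≈; tri>)
open import Relation.Binary.PropositionalEquality
open import Relation.Nullary using (yes; no)
open import Relation.Nullary.Decidable using (⌊_⌋)

detℕ : ℕ → (ℕ → ℕ → ℤ) → ℤ
detℕ n f = det n (λ i j → f (toℕ i) (toℕ j))

detℕ-cong : ∀ n {f g : ℕ → ℕ → ℤ} → (∀ i j → i < n → j < n → f i j ≡ g i j) → detℕ n f ≡ detℕ n g
detℕ-cong n e = det-cong n (λ i j → e (toℕ i) (toℕ j) (toℕ<n i) (toℕ<n j))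

shift : ℕ → ℕ → ℕ → ℕ
shift zero    t j       = t + j
shift (suc a) t zero    = zero
shift (suc a) t (suc j) = suc (shift a t j)

skip : ℕ → ℕ → ℕ
skip a = shift a 1

toℕ-punchIn : ∀ {n} (i : Fin (suc n)) (j : Fin n) → toℕ (punchIn i j) ≡ skip (toℕ i) (toℕ j)
toℕ-punchIn zero    j       = refl
toℕ-punchIn (suc i) zero    = refl
toℕ-punchIn (suc i) (suc j) = cong suc (toℕ-punchIn i j)

shift-below : ∀ {a t j} → j < a → shift a t j ≡ j
shift-below {suc a} {t} {zero}  j<a       = refl
shift-below {suc a} {t} {suc j} (s≤s j<a) = cong suc (shift-below j<a)

shift-above : ∀ {a t j} → a ≤ j → shift a t j ≡ t + j
shift-above {zero}          a≤j       = refl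
shift-above {suc a} {t} {suc j} (s≤s a≤j) = trans (cong suc (shift-above a≤j)) (sym (+-suc t j))

shift-zero : ∀ a j → shift a 0 j ≡ j
shift-zero zero    j       = refl
shift-zero (suc a) zero    = refl
shift-zero (suc a) (suc j) = cong suc (shift-zero a j)

shift-suc : ∀ a b j → shift a (suc b) j ≡ skip (a + b) (shift a b j)
shift-suc zero    b j       = sym (shift-above (m≤m+n b j))
shift-suc (suc a) b zero    = refl
shift-suc (suc a) b (suc j) = cong suc (shift-suc a b j)

skip-bounded : ∀ a {j n} → j < n → skip a j < suc n
skip-bounded zero    j<n             = s≤s j<n
skip-bounded (suc a) {zero}  j<n     = s≤s z≤n
skip-bounded (suc a) {suc j} (s≤s j<n) = s≤s (skip-bounded a j<n)

UnitRow : ℕ → (ℕ → ℤ) → ℕ → Set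
UnitRow n ρ c = ρ c ≡ + 1 × (∀ j → j < n → j ≢ c → ρ j ≡ + 0)

ZeroRow : ℕ → (ℕ → ℤ) → Set
ZeroRow n ρ = ∀ j → j < n → ρ j ≡ + 0

unitRow-skip : ∀ {n ρ c d} → c < d → UnitRow (suc n) ρ c → UnitRow n (ρ ∘ skip d) c
unitRow-skip {n} {ρ} {c} {d} c<d (one , zeros) =
  trans (cong ρ (shift-below c<d)) one ,
  λ j j<n j≢c → zeros (skip d j) (skip-bounded d j<n) (skipped≢c j j≢c)
  where
  skipped≢c : ∀ j → j ≢ c → skip d j ≢ c
  skipped≢c j j≢c with j <? d
  ... | yes j<d = subst (_≢ c) (sym (shift-below j<d)) j≢c
  ... | no  j≮d = subst (_≢ c) (sym (shift-above d≤j)) (>⇒≢ (<-≤-trans c<d (≤-trans d≤j (n≤1+n j))))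
    where
    d≤j : d ≤ j
    d≤j = ≮⇒≥ j≮d

detℕ-unitRow : ∀ n i c (f : ℕ → ℕ → ℤ) → i < suc n → c < suc n → UnitRow (suc n) (f i) c →
  detℕ (suc n) f ≡ sign (i + c) ℤ.* detℕ n (λ r s → f (skip i r) (skip c s))
detℕ-unitRow n i c f i<n c<n (one , zeros) = begin
  detℕ (suc n) f
    ≡⟨ det-unitRow n row col M (trans (cong₂ f toℕ-row toℕ-col) one) others ⟩
  sign (toℕ row) ℤ.* (sign (toℕ col) ℤ.* det n (λ r s → M (punchIn row r) (punchIn col s)))
    ≡⟨ cong₂ (λ x y → sign x ℤ.* (sign y ℤ.* det n (λ r s → M (punchIn row r) (punchIn col s)))) toℕ-row toℕ-col ⟩
  sign i ℤ.* (sign c ℤ.* det n (λ r s → M (punchIn row r) (punchIn col s)))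
    ≡⟨ cong (λ d → sign i ℤ.* (sign c ℤ.* d)) (det-cong n minor-entries) ⟩
  sign i ℤ.* (sign c ℤ.* detℕ n (λ r s → f (skip i r) (skip c s)))
    ≡⟨ sym (*-assoc (sign i) (sign c) _) ⟩
  sign i ℤ.* sign c ℤ.* detℕ n (λ r s → f (skip i r) (skip c s))
    ≡⟨ cong (ℤ._* detℕ n (λ r s → f (skip i r) (skip c s))) (sym (sign-+ i c)) ⟩
  sign (i + c) ℤ.* detℕ n (λ r s → f (skip i r) (skip c s)) ∎
  where
  open ≡-Reasoning
  M : Matrix (suc n)
  M r s = f (toℕ r) (toℕ s)
  row col : Fin (suc n)
  row = fromℕ< i<n
  col = fromℕ< c<n
  toℕ-row : toℕ row ≡ i
  toℕ-row = toℕ-fromℕ< i<n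
  toℕ-col : toℕ col ≡ c
  toℕ-col = toℕ-fromℕ< c<n
  others : ∀ j → j ≢ col → M row j ≡ + 0
  others j j≢col = trans (cong (λ x → f x (toℕ j)) toℕ-row)
                         (zeros (toℕ j) (toℕ<n j) (λ j≡c → j≢col (toℕ-injective (trans j≡c (sym toℕ-col)))))
  minor-entries : ∀ r s → M (punchIn row r) (punchIn col s) ≡ f (skip i (toℕ r)) (skip c (toℕ s))
  minor-entries r s = cong₂ f (trans (toℕ-punchIn row r) (cong (λ x → skip x (toℕ r)) toℕ-row))
                              (trans (toℕ-punchIn col s) (cong (λ x → skip x (toℕ s)) toℕ-col))

detℕ-zeroRow : ∀ n i (f : ℕ → ℕ → ℤ) → i < n → ZeroRow n (f i) → detℕ n f ≡ + 0
detℕ-zeroRow (suc n) i f i<n zeros = det-zeroRow n row (λ r s → f (toℕ r) (toℕ s)) row-zero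
  where
  row : Fin (suc n)
  row = fromℕ< i<n
  row-zero : ∀ j → f (toℕ row) (toℕ j) ≡ + 0
  row-zero j = trans (cong (λ x → f x (toℕ j)) (toℕ-fromℕ< i<n)) (zeros (toℕ j) (toℕ<n j))

expansionTerm : ℕ → (ℕ → ℕ → ℤ) → ℕ → ℤ
expansionTerm n f x = sign x ℤ.* (f 0 x ℤ.* detℕ n (λ r c → f (suc r) (skip x c)))

detℕ-expand : ∀ n (f : ℕ → ℕ → ℤ) → detℕ (suc n) f ≡ sumFin (suc n) (λ j → expansionTerm n f (toℕ j))
detℕ-expand n f = sum-cong (suc n) λ j →
  cong (λ d → sign (toℕ j) ℤ.* (f 0 (toℕ j) ℤ.* d))
       (det-cong n (λ r c → cong (f (suc (toℕ r))) (toℕ-punchIn j c)))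

sum-split : ∀ p q (F : ℕ → ℤ) →
  sumFin (p + q) (F ∘ toℕ) ≡ sumFin p (F ∘ toℕ) ℤ.+ sumFin q (λ j → F (p + toℕ j))
sum-split zero    q F = sym (ℤₚ.+-identityˡ _)
sum-split (suc p) q F =
  trans (cong (ℤ._+_ (F 0)) (sum-split p q (F ∘ suc))) (sym (ℤₚ.+-assoc (F 0) _ _))

detℕ-block : ∀ p q (f : ℕ → ℕ → ℤ) → (∀ i j → i < p → p ≤ j → f i j ≡ + 0) →
  detℕ (p + q) f ≡ detℕ p f ℤ.* detℕ q (λ i j → f (p + i) (p + j))
detℕ-block zero    q f upper = sym (*-identityˡ _)
detℕ-block (suc p) q f upper = begin
  detℕ (suc p + q) f
    ≡⟨ detℕ-expand (p + q) f ⟩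
  sumFin (suc p + q) (expansionTerm (p + q) f ∘ toℕ)
    ≡⟨ sum-split (suc p) q (expansionTerm (p + q) f) ⟩
  sumFin (suc p) (expansionTerm (p + q) f ∘ toℕ) ℤ.+ sumFin q (λ j → expansionTerm (p + q) f (suc p + toℕ j))
    ≡⟨ cong₂ ℤ._+_ (sum-cong (suc p) (λ j → left-column (toℕ j) (toℕ<n j)))
                    (sum-zero q (λ j → right-column (toℕ j))) ⟩
  sumFin (suc p) (λ j → B ℤ.* expansionTerm p f (toℕ j)) ℤ.+ + 0
    ≡⟨ trans (ℤₚ.+-identityʳ _) (sum-*ˡ (suc p) B (expansionTerm p f ∘ toℕ)) ⟩
  B ℤ.* sumFin (suc p) (expansionTerm p f ∘ toℕ)
    ≡⟨ cong (B ℤ.*_) (sym (detℕ-expand p f)) ⟩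
  B ℤ.* detℕ (suc p) f
    ≡⟨ *-comm B _ ⟩
  detℕ (suc p) f ℤ.* B ∎
  where
  open ≡-Reasoning
  B = detℕ q (λ i j → f (suc p + i) (suc p + j))
  right-column : ∀ j → expansionTerm (p + q) f (suc p + j) ≡ + 0
  right-column j = vanishing-term (sign (suc p + j)) (detℕ (p + q) (λ r c → f (suc r) (skip (suc p + j) c)))
                                  (upper 0 (suc p + j) (s≤s z≤n) (m≤m+n (suc p) j))
  -- For a column x ≤ p of the first row, the minor is again block triangular,
  -- with the same lower right block B.
  left-column : ∀ x → x < suc p → expansionTerm (p + q) f x ≡ B ℤ.* expansionTerm p f x
  left-column x (s≤s x≤p) = begin
    sign x ℤ.* (f 0 x ℤ.* detℕ (p + q) minorₓ)
      ≡⟨ cong (λ d → sign x ℤ.* (f 0 x ℤ.* d)) (detℕ-block p q minorₓ minor-upper) ⟩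
    sign x ℤ.* (f 0 x ℤ.* (detℕ p minorₓ ℤ.* detℕ q (λ i j → minorₓ (p + i) (p + j))))
      ≡⟨ cong (λ d → sign x ℤ.* (f 0 x ℤ.* (detℕ p minorₓ ℤ.* d))) (det-cong q minor-lower) ⟩
    sign x ℤ.* (f 0 x ℤ.* (detℕ p minorₓ ℤ.* B))
      ≡⟨ reorder (sign x) (f 0 x) (detℕ p minorₓ) B ⟩
    B ℤ.* (sign x ℤ.* (f 0 x ℤ.* detℕ p minorₓ)) ∎
    where
    minorₓ : ℕ → ℕ → ℤ
    minorₓ r c = f (suc r) (skip x c)
    minor-upper : ∀ i j → i < p → p ≤ j → minorₓ i j ≡ + 0
    minor-upper i j i<p p≤j =
      trans (cong (f (suc i)) (shift-above (≤-trans x≤p p≤j))) (upper (suc i) (suc j) (s≤s i<p) (s≤s p≤j))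
    minor-lower : ∀ (i j : Fin q) → minorₓ (p + toℕ i) (p + toℕ j) ≡ f (suc p + toℕ i) (suc p + toℕ j)
    minor-lower i j = cong (f (suc p + toℕ i)) (shift-above (≤-trans x≤p (m≤m+n p (toℕ j))))
    reorder : ∀ σ y d b → σ ℤ.* (y ℤ.* (d ℤ.* b)) ≡ b ℤ.* (σ ℤ.* (y ℤ.* d))
    reorder = solve-∀

detℕ-peel : ∀ a b c (f : ℕ → ℕ → ℤ) → (∀ r → r < b → UnitRow (a + c + b) (f (a + c + r)) (a + r)) →
  detℕ (a + c + b) f ≡ sign (b * c) ℤ.* detℕ (a + c) (λ i j → f i (shift a b j))
detℕ-peel a zero c f units = begin
  detℕ (a + c + 0) f
    ≡⟨ cong (λ m → detℕ m f) (+-identityʳ (a + c)) ⟩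
  detℕ (a + c) f
    ≡⟨ det-cong (a + c) (λ i j → cong (f (toℕ i)) (sym (shift-zero a (toℕ j)))) ⟩
  detℕ (a + c) (λ i j → f i (shift a 0 j))
    ≡⟨ sym (*-identityˡ _) ⟩
  + 1 ℤ.* detℕ (a + c) (λ i j → f i (shift a 0 j)) ∎
  where open ≡-Reasoning
detℕ-peel a (suc b) c f units = begin
  detℕ (a + c + suc b) f
    ≡⟨ cong (λ m → detℕ m f) (+-suc (a + c) b) ⟩
  detℕ (suc n) f
    ≡⟨ detℕ-unitRow n n (a + b) f (n<1+n n) a+b<1+n (widen (units b (n<1+n b))) ⟩
  sign (n + (a + b)) ℤ.* detℕ n (λ r s → f (skip n r) (skip (a + b) s))
    ≡⟨ cong₂ ℤ._*_ sign-last (detℕ-cong n (λ r s r<n _ → cong (λ x → g x s) (shift-below r<n))) ⟩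
  sign c ℤ.* detℕ n g
    ≡⟨ cong (sign c ℤ.*_) (detℕ-peel a b c g units′) ⟩
  sign c ℤ.* (sign (b * c) ℤ.* detℕ (a + c) (λ i j → g i (shift a b j)))
    ≡⟨ sym (*-assoc (sign c) (sign (b * c)) _) ⟩
  sign c ℤ.* sign (b * c) ℤ.* detℕ (a + c) (λ i j → g i (shift a b j))
    ≡⟨ cong₂ ℤ._*_ (sym (sign-+ c (b * c)))
                    (det-cong (a + c) (λ i j → cong (f (toℕ i)) (sym (shift-suc a b (toℕ j))))) ⟩
  sign (suc b * c) ℤ.* detℕ (a + c) (λ i j → f i (shift a (suc b) j)) ∎
  where
  open ≡-Reasoning
  n = a + c + b
  -- The matrix after deleting column a + b (the last row needs no deletion
  -- inside the remaining n × n corner).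
  g : ℕ → ℕ → ℤ
  g r s = f r (skip (a + b) s)
  a+b<1+n : a + b < suc n
  a+b<1+n = s≤s (+-monoˡ-≤ b (m≤m+n a c))
  widen : ∀ {ρ col} → UnitRow (a + c + suc b) ρ col → UnitRow (suc n) ρ col
  widen {ρ} {col} = subst (λ w → UnitRow w ρ col) (+-suc (a + c) b)
  units′ : ∀ r → r < b → UnitRow n (g (a + c + r)) (a + r)
  units′ r r<b = unitRow-skip (+-monoʳ-< a r<b) (widen (units r (m<n⇒m<1+n r<b)))
  -- The last row sits at index n and its 1 at column a + b; n + (a + b) ≡ c mod 2.
  sign-last : sign (n + (a + b)) ≡ sign c
  sign-last = begin
    sign (n + (a + b))                      ≡⟨ cong sign (regroup a b c) ⟩
    sign (c + ((a + b) + (a + b)))          ≡⟨ sign-+ c _ ⟩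
    sign c ℤ.* sign ((a + b) + (a + b))     ≡⟨ cong (sign c ℤ.*_) (sign-double (a + b)) ⟩
    sign c ℤ.* + 1                          ≡⟨ *-identityʳ (sign c) ⟩
    sign c ∎
    where
    regroup : ∀ a b c → a + c + b + (a + b) ≡ c + ((a + b) + (a + b))
    regroup = ℕ-Solver.solve-∀

detℕ-identity : ∀ n (f : ℕ → ℕ → ℤ) → (∀ r → r < n → UnitRow n (f r) r) → detℕ n f ≡ + 1
detℕ-identity n f units =
  trans (detℕ-peel 0 n 0 f units) (cong (λ e → sign e ℤ.* + 1) (ℕₚ.*-zeroʳ n))

antidiagonal-step : ∀ n (f : ℕ → ℕ → ℤ) →
  (∀ i j → i + j ≡ n → f i j ≡ + 1) → (∀ i j → i ≤ n → j ≤ n → i + j ≢ n → f i j ≡ + 0) →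
  detℕ (suc n) f ≡ sign n ℤ.* detℕ n (λ r s → f (skip n r) (suc s))
antidiagonal-step n f ones zeros =
  trans (detℕ-unitRow n n 0 f (n<1+n n) (s≤s z≤n) (ones n 0 (+-identityʳ n) , lastRow-zeros))
        (cong (λ e → sign e ℤ.* detℕ n (λ r s → f (skip n r) (suc s))) (+-identityʳ n))
  where
  lastRow-zeros : ∀ j → j < suc n → j ≢ 0 → f n j ≡ + 0
  lastRow-zeros j (s≤s j≤n) j≢0 =
    zeros n j ≤-refl j≤n (λ n+j≡n → j≢0 (+-cancelˡ-≡ n j 0 (trans n+j≡n (sym (+-identityʳ n)))))

detℕ-antidiagonal : ∀ n (f : ℕ → ℕ → ℤ) →
  (∀ i j → i + j ≡ n → f i j ≡ + 1) → (∀ i j → i ≤ n → j ≤ n → i + j ≢ n → f i j ≡ + 0) →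
  detℕ (suc n) f ≡ sign (suc n C 2)
detℕ-antidiagonal zero    f ones zeros = antidiagonal-step zero f ones zeros
detℕ-antidiagonal (suc m) f ones zeros = begin
  detℕ (suc n) f
    ≡⟨ antidiagonal-step n f ones zeros ⟩
  sign n ℤ.* detℕ n minor′
    ≡⟨ cong (sign n ℤ.*_) (detℕ-antidiagonal m minor′ ones′ zeros′) ⟩
  sign n ℤ.* sign (n C 2)
    ≡⟨ sym (sign-+ n (n C 2)) ⟩
  sign (n + n C 2)
    ≡⟨ cong (λ x → sign (x + n C 2)) (sym (nC1≡n n)) ⟩
  sign (n C 1 + n C 2)
    ≡⟨ cong sign (nCk+nC[k+1]≡[n+1]C[k+1] n 1) ⟩
  sign (suc n C 2) ∎
  where
  open ≡-Reasoning
  n = suc m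
  minor′ : ℕ → ℕ → ℤ
  minor′ r s = f (skip n r) (suc s)
  unskipped : ∀ {i} → i ≤ m → skip n i ≡ i
  unskipped i≤m = shift-below (s≤s i≤m)
  ones′ : ∀ i j → i + j ≡ m → minor′ i j ≡ + 1
  ones′ i j i+j≡m = trans (cong (λ x → f x (suc j)) (unskipped (subst (i ≤_) i+j≡m (m≤m+n i j))))
                          (ones i (suc j) (trans (+-suc i j) (cong suc i+j≡m)))
  zeros′ : ∀ i j → i ≤ m → j ≤ m → i + j ≢ m → minor′ i j ≡ + 0
  zeros′ i j i≤m j≤m i+j≢m = trans (cong (λ x → f x (suc j)) (unskipped i≤m))
    (zeros i (suc j) (≤-trans i≤m (n≤1+n m)) (s≤s j≤m) (λ e → i+j≢m (suc-injective (trans (sym (+-suc i j)) e))))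

-- The entries of γ^(k) as a function of row and column numbers, so that
-- gamma k N is its restriction to the N × N corner.
γ : ℕ → ℕ → ℕ → ℤ
γ k a b = if ⌊ absDiff a b ℕ.≟ k ⌋ ∨ ⌊ a + b ℕ.≟ k ∸ 1 ⌋ then + 1 else + 0

absDiff-cases : ∀ a b k → ∣ a - b ∣ ≡ k → b ≡ a + k ⊎ a ≡ b + k
absDiff-cases a b k d≡k with ≤-total a b
... | inj₁ a≤b = inj₁ (trans (sym (m+[n∸m]≡n a≤b)) (cong (_+_ a) (trans (sym (m≤n⇒∣m-n∣≡n∸m a≤b)) d≡k)))
... | inj₂ b≤a = inj₂ (trans (sym (m+[n∸m]≡n b≤a)) (cong (_+_ b) (trans (sym (m≤n⇒∣n-m∣≡n∸m b≤a)) d≡k)))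

γ-right : ∀ k a b → b ≡ a + k → γ k a b ≡ + 1
γ-right k a b b≡a+k with absDiff a b ℕ.≟ k
... | yes _ = refl
... | no d≢k = ⊥-elim (d≢k (trans (cong (λ x → ∣ a - x ∣) b≡a+k) (∣m-m+n∣≡n a k)))

γ-left : ∀ k a b → a ≡ b + k → γ k a b ≡ + 1
γ-left k a b a≡b+k with absDiff a b ℕ.≟ k
... | yes _ = refl
... | no d≢k = ⊥-elim (d≢k (trans (∣-∣-comm a b) (trans (cong (λ x → ∣ b - x ∣) a≡b+k) (∣m-m+n∣≡n b k))))

γ-anti : ∀ k a b → a + b ≡ k ∸ 1 → γ k a b ≡ + 1
γ-anti k a b a+b≡k-1 with absDiff a b ℕ.≟ k | a + b ℕ.≟ k ∸ 1
... | yes _ | _     = refl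
... | no _  | yes _ = refl
... | no _  | no a+b≢k-1 = ⊥-elim (a+b≢k-1 a+b≡k-1)

γ-zero : ∀ k a b → b ≢ a + k → a ≢ b + k → a + b ≢ k ∸ 1 → γ k a b ≡ + 0
γ-zero k a b b≢a+k a≢b+k a+b≢k-1 with absDiff a b ℕ.≟ k | a + b ℕ.≟ k ∸ 1
... | yes d≡k | _ with absDiff-cases a b k d≡k
...   | inj₁ b≡a+k = ⊥-elim (b≢a+k b≡a+k)
...   | inj₂ a≡b+k = ⊥-elim (a≢b+k a≡b+k)
γ-zero k a b _ _ a+b≢k-1 | no _ | yes a+b≡k-1 = ⊥-elim (a+b≢k-1 a+b≡k-1)
γ-zero k a b _ _ _       | no _ | no _         = refl

module Gamma (k′ : ℕ) where

  K : ℕ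
  K = suc k′

  D : ℕ → ℤ
  D N = detℕ N (γ K)

  bottom-rows : ∀ m r → r < K → UnitRow (m + K + K) (γ K (m + K + r)) (m + r)
  bottom-rows m r r<K =
    γ-left K (m + K + r) (m + r) (regroup m r k′) ,
    λ j j<N j≢m+r → γ-zero K (m + K + r) j
      (<⇒≢ (<-≤-trans j<N (+-monoˡ-≤ K (m≤m+n (m + K) r))))
      (λ e → j≢m+r (sym (+-cancelʳ-≡ K (m + r) j (trans (sym (regroup m r k′)) e))))
      (>⇒≢ (≤-trans (m≤n+m K m) (≤-trans (m≤m+n (m + K) r) (m≤m+n (m + K + r) j))))
    where
    regroup : ∀ m r k′ → m + suc k′ + r ≡ m + r + suc k′
    regroup = ℕ-Solver.solve-∀

  upper-right-zero : ∀ m i j → i < m → m ≤ j → γ K i (shift m K j) ≡ + 0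
  upper-right-zero m i j i<m m≤j = trans (cong (γ K i) (shift-above m≤j)) (γ-zero K i (K + j)
    (>⇒≢ (subst (i + K <_) (+-comm j K) (+-monoˡ-< K (<-≤-trans i<m m≤j))))
    (<⇒≢ (<-≤-trans i<m (≤-trans m≤j (≤-trans (m≤n+m j K) (m≤m+n (K + j) K)))))
    (>⇒≢ (≤-trans (m≤m+n K j) (m≤n+m (K + j) i))))

  lower-right-identity : ∀ m → detℕ K (λ i j → γ K (m + i) (shift m K (m + j))) ≡ + 1
  lower-right-identity m = detℕ-identity K corner unit
    where
    corner : ℕ → ℕ → ℤ
    corner i j = γ K (m + i) (shift m K (m + j))
    entry : ∀ r s → corner r s ≡ γ K (m + r) (K + (m + s))
    entry r s = cong (γ K (m + r)) (shift-above (m≤m+n m s))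
    unit : ∀ r → r < K → UnitRow K (corner r) r
    unit r r<K =
      trans (entry r r) (γ-right K (m + r) (K + (m + r)) (+-comm K (m + r))) ,
      λ s s<K s≢r → trans (entry r s) (γ-zero K (m + r) (K + (m + s))
        (λ e → s≢r (+-cancelˡ-≡ m s r (+-cancelʳ-≡ K (m + s) (m + r) (trans (+-comm (m + s) K) e))))
        (<⇒≢ (<-≤-trans (+-monoʳ-< m r<K) (≤-trans (+-monoˡ-≤ K (m≤m+n m s)) (+-monoˡ-≤ K (m≤n+m (m + s) K)))))
        (>⇒≢ (≤-trans (m≤m+n K (m + s)) (m≤n+m (K + (m + s)) (m + r)))))

  recurrence : ∀ m → D (m + K + K) ≡ sign K ℤ.* D m
  recurrence m = begin
    D (m + K + K)
      ≡⟨ detℕ-peel m K K (γ K) (bottom-rows m) ⟩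
    sign (K * K) ℤ.* detℕ (m + K) shifted
      ≡⟨ cong₂ ℤ._*_ (sign-square K) (detℕ-block m K shifted (upper-right-zero m)) ⟩
    sign K ℤ.* (detℕ m shifted ℤ.* detℕ K (λ i j → shifted (m + i) (m + j)))
      ≡⟨ cong₂ (λ x y → sign K ℤ.* (x ℤ.* y))
               (detℕ-cong m (λ i j _ j<m → cong (γ K i) (shift-below j<m))) (lower-right-identity m) ⟩
    sign K ℤ.* (D m ℤ.* + 1)
      ≡⟨ cong (sign K ℤ.*_) (*-identityʳ (D m)) ⟩
    sign K ℤ.* D m ∎
    where
    open ≡-Reasoning
    shifted : ℕ → ℕ → ℤ
    shifted i j = γ K i (shift m K j)

  period : ∀ q r → D (2 * K * q + r) ≡ sign (K * q) ℤ.* D r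
  period zero    r = begin
    D (2 * K * 0 + r)          ≡⟨ cong (λ x → D (x + r)) (ℕₚ.*-zeroʳ (2 * K)) ⟩
    D r                        ≡⟨ sym (*-identityˡ (D r)) ⟩
    sign 0 ℤ.* D r             ≡⟨ cong (λ e → sign e ℤ.* D r) (sym (ℕₚ.*-zeroʳ K)) ⟩
    sign (K * 0) ℤ.* D r ∎
    where open ≡-Reasoning
  period (suc q) r = begin
    D (2 * K * suc q + r)                       ≡⟨ cong D (unfold k′ q r) ⟩
    D (2 * K * q + r + K + K)                   ≡⟨ recurrence (2 * K * q + r) ⟩
    sign K ℤ.* D (2 * K * q + r)                ≡⟨ cong (sign K ℤ.*_) (period q r) ⟩
    sign K ℤ.* (sign (K * q) ℤ.* D r)           ≡⟨ sym (*-assoc (sign K) (sign (K * q)) (D r)) ⟩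
    sign K ℤ.* sign (K * q) ℤ.* D r             ≡⟨ cong (ℤ._* D r) (sym (sign-+ K (K * q))) ⟩
    sign (K + K * q) ℤ.* D r                    ≡⟨ cong (λ e → sign e ℤ.* D r) (sym (*-suc K q)) ⟩
    sign (K * suc q) ℤ.* D r ∎
    where
    open ≡-Reasoning
    unfold : ∀ k′ q r → 2 * suc k′ * suc q + r ≡ 2 * suc k′ * q + r + suc k′ + suc k′
    unfold = ℕ-Solver.solve-∀

  D-K : D K ≡ sign (K C 2)
  D-K = detℕ-antidiagonal k′ (γ K) (γ-anti K) λ i j i≤k′ j≤k′ i+j≢k′ → γ-zero K i j
    (<⇒≢ (<-≤-trans (s≤s j≤k′) (m≤n+m K i)))
    (<⇒≢ (<-≤-trans (s≤s i≤k′) (m≤n+m K j)))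
    i+j≢k′

  D-small : ∀ N → 0 < N → N < K → D N ≡ + 0
  D-small N 0<N N<K = detℕ-zeroRow N 0 (γ K) 0<N λ j j<N → γ-zero K 0 j
    (<⇒≢ (<-trans j<N N<K))
    (<⇒≢ (<-≤-trans (s≤s z≤n) (m≤n+m K j)))
    (<⇒≢ (<-≤-trans j<N (ℕ.s≤s⁻¹ N<K)))

  -- For K < N < 2K, row K of γ_N is a unit row at column 0; deleting it and
  -- column 0 leaves row k′ (which had its only 1 in column 0 as well) zero.
  D-middle : ∀ N → K < N → N < K + K → D N ≡ + 0
  D-middle (suc n) K<N N<2K = begin
    D (suc n)
      ≡⟨ detℕ-unitRow n K 0 (γ K) K<N (s≤s z≤n) row-K ⟩
    sign (K + 0) ℤ.* detℕ n minor′
      ≡⟨ cong (sign (K + 0) ℤ.*_) (detℕ-zeroRow n k′ minor′ (ℕ.s≤s⁻¹ K<N) row-k′) ⟩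
    sign (K + 0) ℤ.* + 0
      ≡⟨ *-zeroʳ (sign (K + 0)) ⟩
    + 0 ∎
    where
    open ≡-Reasoning
    minor′ : ℕ → ℕ → ℤ
    minor′ r s = γ K (skip K r) (suc s)
    row-K : UnitRow (suc n) (γ K K) 0
    row-K = γ-left K K 0 refl , λ j j<N j≢0 → γ-zero K K j
      (<⇒≢ (<-trans j<N N<2K))
      (λ e → j≢0 (sym (+-cancelʳ-≡ K 0 j e)))
      (>⇒≢ (m≤m+n K j))
    row-k′ : ZeroRow n (minor′ k′)
    row-k′ s s<n = trans (cong (λ x → γ K x (suc s)) (shift-below (n<1+n k′))) (γ-zero K k′ (suc s)
      (<⇒≢ (<-≤-trans (s≤s s<n) (ℕ.s≤s⁻¹ N<2K)))
      (<⇒≢ (<-≤-trans (n<1+n k′) (m≤n+m K (suc s))))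
      (>⇒≢ (m<m+n k′ (s≤s z≤n))))

  D-vanish : ∀ r → r < 2 * K → r ≢ 0 → r ≢ K → D r ≡ + 0
  D-vanish r r<2K r≢0 r≢K with <-cmp r K
  ... | tri< r<K _ _ = D-small r (n≢0⇒n>0 r≢0) r<K
  ... | tri≈ _ r≡K _ = ⊥-elim (r≢K r≡K)
  ... | tri> _ _ K<r = D-middle r K<r (subst (r <_) (cong (_+_ K) (+-identityʳ K)) r<2K)

  D-even : ∀ n → D (2 * K * n) ≡ sign (K * n)
  D-even n = begin
    D (2 * K * n)                ≡⟨ cong D (sym (+-identityʳ (2 * K * n))) ⟩
    D (2 * K * n + 0)            ≡⟨ period n 0 ⟩
    sign (K * n) ℤ.* + 1         ≡⟨ *-identityʳ (sign (K * n)) ⟩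
    sign (K * n) ∎
    where open ≡-Reasoning

  D-odd : ∀ n → D (2 * K * n + K) ≡ sign (K * n + K C 2)
  D-odd n = begin
    D (2 * K * n + K)                  ≡⟨ period n K ⟩
    sign (K * n) ℤ.* D K               ≡⟨ cong (sign (K * n) ℤ.*_) D-K ⟩
    sign (K * n) ℤ.* sign (K C 2)      ≡⟨ sym (sign-+ (K * n) (K C 2)) ⟩
    sign (K * n + K C 2) ∎
    where open ≡-Reasoning

  D-other : ∀ N → (∀ n → N ≢ 2 * K * n) → (∀ n → N ≢ 2 * K * n + K) → D N ≡ + 0
  D-other N not-even not-odd = begin
    D N                      ≡⟨ cong D N≡2Kq+r ⟩
    D (2 * K * q + r)        ≡⟨ period q r ⟩
    sign (K * q) ℤ.* D r     ≡⟨ cong (sign (K * q) ℤ.*_) (D-vanish r (m%n<n N (2 * K)) r≢0 r≢K) ⟩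
    sign (K * q) ℤ.* + 0     ≡⟨ *-zeroʳ (sign (K * q)) ⟩
    + 0 ∎
    where
    open ≡-Reasoning
    q r : ℕ
    q = N / (2 * K)
    r = N % (2 * K)
    N≡2Kq+r : N ≡ 2 * K * q + r
    N≡2Kq+r = trans (m≡m%n+[m/n]*n N (2 * K)) (trans (+-comm r (q * (2 * K))) (cong (_+ r) (ℕₚ.*-comm q (2 * K))))
    r≢0 : r ≢ 0
    r≢0 r≡0 = not-even q (trans N≡2Kq+r (trans (cong (_+_ (2 * K * q)) r≡0) (+-identityʳ (2 * K * q))))
    r≢K : r ≢ K
    r≢K r≡K = not-odd q (trans N≡2Kq+r (cong (_+_ (2 * K * q)) r≡K))

lemma4p3 : (k : ℕ) → k ≥ 1 →
    ((n : ℕ) → det (2 * k * n) (gamma k (2 * k * n)) ≡ sign (k * n))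
    × ((n : ℕ) → det (2 * k * n + k) (gamma k (2 * k * n + k)) ≡ sign (k * n + k C 2))
    × ((N : ℕ) → ((n : ℕ) → N ≢ 2 * k * n) → ((n : ℕ) → N ≢ 2 * k * n + k) → det N (gamma k N) ≡ + 0)
lemma4p3 zero    ()
lemma4p3 (suc k′) _ = D-even , D-odd , D-other
  where open Gamma k′
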